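{- Let $L$ be a sufficiently large integer such that $L+1$ is a power of $2$, and let $\mathcal{I}=(J,p,r,d)$ be the instance of $1|r_j,d_j|\sum_j p_jU'_j$ whose jobs form a full binary tree with levels $0,\dots,L$: for each $\ell\in\{0,\dots,L\}$ and $k\in\{1,\dots,2^\ell\}$ there is a job $j$ (the $k$-th job of level $\ell$) with $p_j=2^{L-\ell}$, $r_j=(L+1)(k-1)2^{L-\ell}$ and $d_j=(L+1)k2^{L-\ell}$. Let $T:=\sum_{j\in J}p_j=(L+1)2^L$. Then every valid solution to $\mathcal{I}$ has cost at least $0.2T$.
   Context: The problem $1|r_j,d_j|\sum_j p_jU'_j$: one machine and a set $J$ of jobs, each with size $p_j\in\mathbb{Z}_{>0}$, release time $r_j\in\mathbb{Z}_{\ge0}$ and deadline $d_j\ge r_j+p_j$. A solution chooses for each job a length $p'_j\in[0,p_j]$ and processes $j$ non-preemptively during an interval of length $p'_j$ contained in $(r_j,d_j]$, with processing intervals of distinct jobs disjoint; its cost is $\sum_j(p_j-p'_j)$.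
   Formalization: Solutions are taken with rational start times and rational lengths $p'_j$. -}

module Defs where

open import Data.Nat as ℕ using (ℕ; zero; suc; _^_; _∸_)
open import Data.Fin using (Fin; toℕ)
import Data.Fin as Fin
open import Data.Integer using (+_)
open import Data.Rational using (ℚ; _+_; _*_; _-_; _≤_; _<_; 0ℚ; _/_)
open import Data.Product using (Σ; _×_; _,_; proj₁; proj₂)
open import Data.Sum using (_⊎_)
open import Relation.Nullary using (¬_)
open import Relation.Binary.PropositionalEquality using (_≡_; _≢_)

ℕ→ℚ : ℕ → ℚ
ℕ→ℚ n = (+ n) / 1

sumFin : (n : ℕ) → (Fin n → ℚ) → ℚ
sumFin zero    f = 0ℚ
sumFin (suc n) f = f Fin.zero + sumFin n (λ i → f (Fin.suc i))

-- Jobs of the binary-tree instance with levels 0..L: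
-- (ℓ , k) with ℓ ∈ {0..L}, k ∈ {0..2^ℓ-1} (k is the paper's k-1).
Job : ℕ → Set
Job L = Σ (Fin (suc L)) (λ ℓ → Fin (2 ^ toℕ ℓ))

size : (L : ℕ) → Job L → ℕ
size L (ℓ , k) = 2 ^ (L ∸ toℕ ℓ)

release : (L : ℕ) → Job L → ℕ
release L (ℓ , k) = suc L ℕ.* toℕ k ℕ.* 2 ^ (L ∸ toℕ ℓ)

deadline : (L : ℕ) → Job L → ℕ
deadline L (ℓ , k) = suc L ℕ.* suc (toℕ k) ℕ.* 2 ^ (L ∸ toℕ ℓ)

sumJobs : (L : ℕ) → (Job L → ℚ) → ℚ
sumJobs L f = sumFin (suc L) (λ ℓ → sumFin (2 ^ toℕ ℓ) (λ k → f (ℓ , k)))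

totalSize : ℕ → ℚ
totalSize L = sumJobs L (λ j → ℕ→ℚ (size L j))

-- A solution: each job j gets a start time s_j and a length p'_j;
-- it is processed during the half-open interval (s_j, s_j + p'_j].
record Solution (L : ℕ) : Set where
  field
    start  : Job L → ℚ
    len    : Job L → ℚ

_∈⟨_,_] : ℚ → ℚ → ℚ → Set
t ∈⟨ a , b ] = (a < t) × (t ≤ b)

Valid : (L : ℕ) → Solution L → Set
Valid L sol =
  ((j : Job L) → (0ℚ ≤ len j) × (len j ≤ ℕ→ℚ (size L j)))
  × ((j : Job L) (t : ℚ) → t ∈⟨ start j , start j + len j ] →
       t ∈⟨ ℕ→ℚ (release L j) , ℕ→ℚ (deadline L j) ])
  × ((j j' : Job L) → j ≢ j' → (t : ℚ) →
       ¬ (t ∈⟨ start j , start j + len j ] × t ∈⟨ start j' , start j' + len j' ]))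
  where open Solution sol

cost : (L : ℕ) → Solution L → ℚ
cost L sol = sumJobs L (λ j → ℕ→ℚ (size L j) - Solution.len sol j)

-- Write L + 1 = 2H with H = 2^m, let c = m + 6 and Q = 2^c = 64H; a job is big if its level is
-- below H, and a level is deep if it is at least H + c.  At a deep level, the processing interval
-- of a big job contains all but at most two of the release/deadline windows it meets.  A job whose
-- window is contained in another job's processing interval cannot be processed at all, and its
-- window lies in at most one processing interval.  As a big job is at least Q times longer than a
-- deep one, every deep level therefore loses at least Y/(L + 1) - 2P/Q, where P = H 2^L is the
-- total size of the big jobs and Y the time they are processed, while the big jobs lose P - Y.
-- With H - c deep levels the cost is at least (H - c)(1/2 - 1/32) 2^L, which exceeds
-- T/5 = (2/5) H 2^L once 8c ≤ H, i.e. for L ≥ 255.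

module Submission where

open import Defs
open import Algebra.Bundles using (CommutativeRing)
open import Data.Bool using (if_then_else_)
open import Data.Empty using (⊥; ⊥-elim)
open import Data.Fin using (Fin; toℕ; zero; suc)
import Data.Fin.Properties as Fin
import Data.Integer.Properties as ℤ
import Data.Integer as ℤ
open import Data.Nat as ℕ using (ℕ; zero; suc; _^_; _∸_; _≥_; z≤n; s≤s)
import Data.Nat.Properties as ℕ
import Data.Nat.Coprimality as Coprimality
open import Data.Product using (Σ; ∃; _×_; _,_; proj₁; proj₂)
open import Data.Rational hiding (_≥_)
open import Data.Rational.Properties
open import Function using (_∘_)
open import Level using (0ℓ)
open import Relation.Nullary using (Dec; yes; no; does; ¬_)
open import Relation.Nullary.Decidable using (_×-dec_; dec⇒maybe)
open import Relation.Binary.PropositionalEquality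
open import Tactic.RingSolver using (solve-∀)
import Data.Nat.Tactic.RingSolver as ℕ-Solver
open import Tactic.RingSolver.Core.AlmostCommutativeRing using (AlmostCommutativeRing; fromCommutativeRing)
open import Algebra.Properties.Semiring.Sum (CommutativeRing.semiring +-*-commutativeRing)

ℚ-ring : AlmostCommutativeRing 0ℓ 0ℓ
ℚ-ring = fromCommutativeRing +-*-commutativeRing (λ q → dec⇒maybe (0ℚ ≟ q))

ℕ→ℚ≡mkℚ : ∀ n → ℕ→ℚ n ≡ mkℚ (ℤ.+ n) 0 (Coprimality.sym (Coprimality.1-coprimeTo n))
ℕ→ℚ≡mkℚ n = ↥p/↧p≡p (mkℚ (ℤ.+ n) 0 (Coprimality.sym (Coprimality.1-coprimeTo n)))

ℕ→ℚ-+ : ∀ m n → ℕ→ℚ (m ℕ.+ n) ≡ ℕ→ℚ m + ℕ→ℚ n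
ℕ→ℚ-+ m n rewrite ℕ→ℚ≡mkℚ m | ℕ→ℚ≡mkℚ n =
  /-cong (trans (ℤ.pos-+ m n) (sym (cong₂ ℤ._+_ (ℤ.*-identityʳ (ℤ.+ m)) (ℤ.*-identityʳ (ℤ.+ n))))) refl

ℕ→ℚ-* : ∀ m n → ℕ→ℚ (m ℕ.* n) ≡ ℕ→ℚ m * ℕ→ℚ n
ℕ→ℚ-* m n rewrite ℕ→ℚ≡mkℚ m | ℕ→ℚ≡mkℚ n = /-cong (ℤ.pos-* m n) refl

ℕ→ℚ-mono-≤ : ∀ {m n} → m ℕ.≤ n → ℕ→ℚ m ≤ ℕ→ℚ n
ℕ→ℚ-mono-≤ {m} {n} m≤n rewrite ℕ→ℚ≡mkℚ m | ℕ→ℚ≡mkℚ n =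
  *≤* (subst₂ ℤ._≤_ (sym (ℤ.*-identityʳ (ℤ.+ m))) (sym (ℤ.*-identityʳ (ℤ.+ n))) (ℤ.+≤+ m≤n))

ℕ→ℚ-mono-< : ∀ {m n} → m ℕ.< n → ℕ→ℚ m < ℕ→ℚ n
ℕ→ℚ-mono-< {m} {n} m<n rewrite ℕ→ℚ≡mkℚ m | ℕ→ℚ≡mkℚ n =
  *<* (subst₂ ℤ._<_ (sym (ℤ.*-identityʳ (ℤ.+ m))) (sym (ℤ.*-identityʳ (ℤ.+ n))) (ℤ.+<+ m<n))

ℕ→ℚ-nonNeg : ∀ n → 0ℚ ≤ ℕ→ℚ n
ℕ→ℚ-nonNeg n = ℕ→ℚ-mono-≤ {0} {n} z≤n

p≤q⇒0≤q-p : ∀ {p q} → p ≤ q → 0ℚ ≤ q - p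
p≤q⇒0≤q-p {p} {q} p≤q = subst (_≤ q - p) (+-inverseʳ p) (+-monoˡ-≤ (- p) p≤q)

p+q-p≡q : ∀ p q → p + q - p ≡ q
p+q-p≡q = solve-∀ ℚ-ring

p≤q+r⇒p-q≤r : ∀ {p q r} → p ≤ q + r → p - q ≤ r
p≤q+r⇒p-q≤r {p} {q} {r} p≤q+r = subst (p - q ≤_) (p+q-p≡q q r) (+-monoˡ-≤ (- q) p≤q+r)

p≤q⇒p-q≤0 : ∀ {p q} → p ≤ q → p - q ≤ 0ℚ
p≤q⇒p-q≤0 {p} {q} p≤q = subst (p - q ≤_) (+-inverseʳ q) (+-monoˡ-≤ (- q) p≤q)

≤-by-difference : ∀ {p q} r → q - p ≡ r → 0ℚ ≤ r → p ≤ q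
≤-by-difference {p} {q} r q-p≡r 0≤r =
  subst₂ _≤_ (+-identityˡ p) (cancel p q) (+-monoˡ-≤ p (subst (0ℚ ≤_) (sym q-p≡r) 0≤r))
  where
  cancel : ∀ p q → q - p + p ≡ q
  cancel = solve-∀ ℚ-ring

p<p+q : ∀ p {q} → 0ℚ < q → p < p + q
p<p+q p 0<q = subst (_< p + _) (+-identityʳ p) (+-monoʳ-< p 0<q)

*-nonNeg : ∀ {p q} → 0ℚ ≤ p → 0ℚ ≤ q → 0ℚ ≤ p * q
*-nonNeg {p} {q} 0≤p 0≤q =
  nonNegative⁻¹ (p * q) {{nonNeg*nonNeg⇒nonNeg p {{nonNegative 0≤p}} q {{nonNegative 0≤q}}}}

𝟙 : {A : Set} → Dec A → ℚ
𝟙 a? = if does a? then 1ℚ else 0ℚ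

module _ {A : Set} where

  𝟙-nonNeg : (a? : Dec A) → 0ℚ ≤ 𝟙 a?
  𝟙-nonNeg (yes _) = ℕ→ℚ-nonNeg 1
  𝟙-nonNeg (no _)  = ≤-refl

  𝟙≤1 : (a? : Dec A) → 𝟙 a? ≤ 1ℚ
  𝟙≤1 (yes _) = ≤-refl
  𝟙≤1 (no _)  = ℕ→ℚ-nonNeg 1

  𝟙-yes : (a? : Dec A) → A → 𝟙 a? ≡ 1ℚ
  𝟙-yes (yes _) _ = refl
  𝟙-yes (no ¬a) a = ⊥-elim (¬a a)

  𝟙-pos⇒ : (a? : Dec A) → 0ℚ < 𝟙 a? → A
  𝟙-pos⇒ (yes a) _   = a
  𝟙-pos⇒ (no _)  0<0 = ⊥-elim (<-irrefl refl 0<0)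

  𝟙-cong : {B : Set} (a? : Dec A) (b? : Dec B) → (A → B) → (B → A) → 𝟙 a? ≡ 𝟙 b?
  𝟙-cong (yes _) (yes _) _   _   = refl
  𝟙-cong (yes a) (no ¬b) a→b _   = ⊥-elim (¬b (a→b a))
  𝟙-cong (no ¬a) (yes b) _   b→a = ⊥-elim (¬a (b→a b))
  𝟙-cong (no _)  (no _)  _   _   = refl

  𝟙-×-dec : {B : Set} (a? : Dec A) (b? : Dec B) → 𝟙 (a? ×-dec b?) ≡ 𝟙 a? * 𝟙 b?
  𝟙-×-dec (yes _) b? = sym (*-identityˡ (𝟙 b?))
  𝟙-×-dec (no _)  b? = sym (*-zeroˡ (𝟙 b?))

sumFin≡sum : ∀ n (f : Fin n → ℚ) → sumFin n f ≡ sum f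
sumFin≡sum zero    f = refl
sumFin≡sum (suc n) f = cong (f zero +_) (sumFin≡sum n (f ∘ suc))

∑-mono-≤ : ∀ {n} {f g : Fin n → ℚ} → (∀ i → f i ≤ g i) → sum f ≤ sum g
∑-mono-≤ {zero}  f≤g = ≤-refl
∑-mono-≤ {suc n} f≤g = +-mono-≤ (f≤g zero) (∑-mono-≤ (f≤g ∘ suc))

∑-nonNeg : ∀ {n} {f : Fin n → ℚ} → (∀ i → 0ℚ ≤ f i) → 0ℚ ≤ sum f
∑-nonNeg {n} {f} 0≤f = subst (_≤ sum f) (sum-replicate-zero n) (∑-mono-≤ 0≤f)

∑-const : ∀ n c → ∑[ i < n ] c ≡ ℕ→ℚ n * c
∑-const zero    c = sym (*-zeroˡ c)
∑-const (suc n) c = begin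
  c + ∑[ i < n ] c      ≡⟨ cong (c +_) (∑-const n c) ⟩
  c + ℕ→ℚ n * c        ≡⟨ factor c (ℕ→ℚ n) ⟩
  (1ℚ + ℕ→ℚ n) * c     ≡⟨ cong (_* c) (sym (ℕ→ℚ-+ 1 n)) ⟩
  ℕ→ℚ (suc n) * c      ∎
  where
  open ≡-Reasoning
  factor : ∀ c m → c + m * c ≡ (1ℚ + m) * c
  factor = solve-∀ ℚ-ring

∑-pos⇒ : ∀ {n} (f : Fin n → ℚ) → 0ℚ < sum f → ∃ λ i → 0ℚ < f i
∑-pos⇒ {zero}  f 0<0 = ⊥-elim (<-irrefl refl 0<0)
∑-pos⇒ {suc n} f 0<∑ with 0ℚ <? f zero
... | yes 0<f₀ = zero , 0<f₀
... | no 0≮f₀  = let i , 0<fᵢ = ∑-pos⇒ (f ∘ suc) 0<∑f∘suc in suc i , 0<fᵢ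
  where
  0<∑f∘suc : 0ℚ < sum (f ∘ suc)
  0<∑f∘suc = subst (0ℚ <_) (+-identityˡ _) (<-≤-trans 0<∑ (+-monoˡ-≤ (sum (f ∘ suc)) (≮⇒≥ 0≮f₀)))

AtMostOnePositive : {I : Set} → (I → ℚ) → Set
AtMostOnePositive f = ∀ i i′ → i ≢ i′ → 0ℚ < f i → 0ℚ < f i′ → ⊥

∑-≤1 : ∀ {n} {f : Fin n → ℚ} → (∀ i → 0ℚ ≤ f i) → (∀ i → f i ≤ 1ℚ) → AtMostOnePositive f →
       sum f ≤ 1ℚ
∑-≤1 {zero}          0≤f f≤1 one = ℕ→ℚ-nonNeg 1
∑-≤1 {suc n} {f} 0≤f f≤1 one with 0ℚ <? f zero
... | yes 0<f₀ = subst (f zero + sum (f ∘ suc) ≤_) (+-identityʳ 1ℚ) (+-mono-≤ (f≤1 zero) ∑f∘suc≤0)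
  where
  ∑f∘suc≤0 : sum (f ∘ suc) ≤ 0ℚ
  ∑f∘suc≤0 = subst (sum (f ∘ suc) ≤_) (sum-replicate-zero n)
               (∑-mono-≤ λ i → ≮⇒≥ (one zero (suc i) (λ ()) 0<f₀))
... | no 0≮f₀ = subst (f zero + sum (f ∘ suc) ≤_) (+-identityˡ 1ℚ)
                  (+-mono-≤ (≮⇒≥ 0≮f₀)
                    (∑-≤1 (0≤f ∘ suc) (f≤1 ∘ suc) λ i i′ i≢i′ → one (suc i) (suc i′) (i≢i′ ∘ Fin.suc-injective)))

∑-𝟙-< : ∀ {n H} → H ℕ.≤ n → ∑[ i < n ] 𝟙 (toℕ i ℕ.<? H) ≡ ℕ→ℚ H
∑-𝟙-< {n}     {zero}  _         = sum-replicate-zero n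
∑-𝟙-< {suc n} {suc H} (s≤s H≤n) = trans (cong (1ℚ +_) (∑-𝟙-< H≤n)) (sym (ℕ→ℚ-+ 1 H))

∑-𝟙-≥ : ∀ n g → ∑[ i < n ] 𝟙 (g ℕ.≤? toℕ i) ≡ ℕ→ℚ (n ∸ g)
∑-𝟙-≥ n       zero    = trans (∑-const n 1ℚ) (*-identityʳ (ℕ→ℚ n))
∑-𝟙-≥ zero    (suc g) = refl
∑-𝟙-≥ (suc n) (suc g) = begin
  0ℚ + ∑[ i < n ] 𝟙 (suc g ℕ.≤? suc (toℕ i))  ≡⟨ +-identityˡ (∑[ i < n ] 𝟙 (suc g ℕ.≤? suc (toℕ i))) ⟩
  ∑[ i < n ] 𝟙 (suc g ℕ.≤? suc (toℕ i))
    ≡⟨ sum-cong-≗ {n} (λ i → 𝟙-cong (suc g ℕ.≤? suc (toℕ i)) (g ℕ.≤? toℕ i) ℕ.s≤s⁻¹ s≤s) ⟩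
  ∑[ i < n ] 𝟙 (g ℕ.≤? toℕ i)                 ≡⟨ ∑-𝟙-≥ n g ⟩
  ℕ→ℚ (n ∸ g)                                 ∎
  where open ≡-Reasoning

∑ⱼ : (L : ℕ) → (Job L → ℚ) → ℚ
∑ⱼ L f = ∑[ ℓ < suc L ] ∑[ k < 2 ^ toℕ ℓ ] f (ℓ , k)

module _ {L : ℕ} where

  sumJobs≡∑ⱼ : (f : Job L → ℚ) → sumJobs L f ≡ ∑ⱼ L f
  sumJobs≡∑ⱼ f = trans (sumFin≡sum (suc L) (λ ℓ → sumFin (2 ^ toℕ ℓ) (λ k → f (ℓ , k))))
                       (sum-cong-≗ λ ℓ → sumFin≡sum (2 ^ toℕ ℓ) (λ k → f (ℓ , k)))

  ∑ⱼ-mono-≤ : {f g : Job L → ℚ} → (∀ j → f j ≤ g j) → ∑ⱼ L f ≤ ∑ⱼ L g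
  ∑ⱼ-mono-≤ f≤g = ∑-mono-≤ λ ℓ → ∑-mono-≤ λ k → f≤g (ℓ , k)

  ∑ⱼ-cong : {f g : Job L → ℚ} → (∀ j → f j ≡ g j) → ∑ⱼ L f ≡ ∑ⱼ L g
  ∑ⱼ-cong f≡g = sum-cong-≗ λ ℓ → sum-cong-≗ λ k → f≡g (ℓ , k)

  ∑ⱼ-distrib-+ : (f g : Job L → ℚ) → ∑ⱼ L (λ j → f j + g j) ≡ ∑ⱼ L f + ∑ⱼ L g
  ∑ⱼ-distrib-+ f g = trans (sum-cong-≗ λ ℓ → ∑-distrib-+ (λ k → f (ℓ , k)) (λ k → g (ℓ , k)))
                          (∑-distrib-+ (λ ℓ → ∑[ k < 2 ^ toℕ ℓ ] f (ℓ , k)) (λ ℓ → ∑[ k < 2 ^ toℕ ℓ ] g (ℓ , k)))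

  *-distribˡ-∑ⱼ : ∀ c (f : Job L → ℚ) → c * ∑ⱼ L f ≡ ∑ⱼ L (λ j → c * f j)
  *-distribˡ-∑ⱼ c f = trans (*-distribˡ-sum c (λ ℓ → ∑[ k < 2 ^ toℕ ℓ ] f (ℓ , k)))
                            (sum-cong-≗ λ ℓ → *-distribˡ-sum c (λ k → f (ℓ , k)))

  ∑ⱼ-by-level : (c : Fin (suc L) → ℚ) (f : Job L → ℚ) →
                ∑ⱼ L (λ j → c (proj₁ j) * f j) ≡ ∑[ ℓ < suc L ] (c ℓ * ∑[ k < 2 ^ toℕ ℓ ] f (ℓ , k))
  ∑ⱼ-by-level c f = sum-cong-≗ λ ℓ → sym (*-distribˡ-sum (c ℓ) (λ k → f (ℓ , k)))

  ∑-∑ⱼ-comm : ∀ {K} (f : Fin K → Job L → ℚ) → ∑[ i < K ] ∑ⱼ L (f i) ≡ ∑ⱼ L (λ j → ∑[ i < K ] f i j)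
  ∑-∑ⱼ-comm f = trans (∑-comm (λ i ℓ → ∑[ k < 2 ^ toℕ ℓ ] f i (ℓ , k)))
                      (sum-cong-≗ λ ℓ → ∑-comm (λ i k → f i (ℓ , k)))

  ∑ⱼ-pos⇒ : (f : Job L → ℚ) → 0ℚ < ∑ⱼ L f → ∃ λ j → 0ℚ < f j
  ∑ⱼ-pos⇒ f 0<∑ with ∑-pos⇒ (λ ℓ → ∑[ k < 2 ^ toℕ ℓ ] f (ℓ , k)) 0<∑
  ... | ℓ , 0<∑ℓ with ∑-pos⇒ (λ k → f (ℓ , k)) 0<∑ℓ
  ... | k , 0<f = (ℓ , k) , 0<f

  ∑ⱼ-≤1 : {f : Job L → ℚ} → (∀ j → 0ℚ ≤ f j) → (∀ j → f j ≤ 1ℚ) → AtMostOnePositive f → ∑ⱼ L f ≤ 1ℚ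
  ∑ⱼ-≤1 {f} 0≤f f≤1 one = ∑-≤1 (λ ℓ → ∑-nonNeg λ k → 0≤f (ℓ , k)) level≤1 levels-exclusive
    where
    level≤1 : ∀ ℓ → ∑[ k < 2 ^ toℕ ℓ ] f (ℓ , k) ≤ 1ℚ
    level≤1 ℓ = ∑-≤1 (λ k → 0≤f (ℓ , k)) (λ k → f≤1 (ℓ , k)) λ k k′ k≢k′ →
      one (ℓ , k) (ℓ , k′) (λ eq → k≢k′ (Fin.toℕ-injective (cong (toℕ ∘ proj₂) eq)))
    levels-exclusive : AtMostOnePositive (λ ℓ → ∑[ k < 2 ^ toℕ ℓ ] f (ℓ , k))
    levels-exclusive ℓ ℓ′ ℓ≢ℓ′ 0<∑ℓ 0<∑ℓ′ with ∑-pos⇒ (λ k → f (ℓ , k)) 0<∑ℓ | ∑-pos⇒ (λ k → f (ℓ′ , k)) 0<∑ℓ′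
    ... | k , 0<f | k′ , 0<f′ = one (ℓ , k) (ℓ′ , k′) (ℓ≢ℓ′ ∘ cong proj₁) 0<f 0<f′

StepsAtMost : ℚ → (ℕ → ℚ) → Set
StepsAtMost δ t = ∀ i → t i ≤ t (suc i) × t (suc i) - t i ≤ δ

windowsIn : (ℕ → ℚ) → ℚ → ℚ → ℕ → ℚ
windowsIn t a b K = ∑[ i < K ] 𝟙 ((a ≤? t (toℕ i)) ×-dec (t (suc (toℕ i)) ≤? b))

windowsIn-nonNeg : ∀ {a b} t K → 0ℚ ≤ windowsIn t a b K
windowsIn-nonNeg {a} {b} t K = ∑-nonNeg {K} λ i → 𝟙-nonNeg ((a ≤? t (toℕ i)) ×-dec (t (suc (toℕ i)) ≤? b))

module _ {δ a b : ℚ} where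

  steps-nonNeg : ∀ {t} → StepsAtMost δ t → 0ℚ ≤ δ
  steps-nonNeg steps = ≤-trans (p≤q⇒0≤q-p (proj₁ (steps 0))) (proj₂ (steps 0))

  windowsIn-tail≤ : ∀ t K → 0ℚ ≤ δ → ∀ c → δ * (windowsIn (t ∘ suc) a b K + c) ≤ δ * (windowsIn t a b (suc K) + c)
  windowsIn-tail≤ t K 0≤δ c = *-monoˡ-≤-nonNeg δ {{nonNegative 0≤δ}} (+-monoˡ-≤ c
    (subst (_≤ windowsIn t a b (suc K)) (+-identityˡ (windowsIn (t ∘ suc) a b K))
      (+-monoˡ-≤ (windowsIn (t ∘ suc) a b K) (𝟙-nonNeg ((a ≤? t 0) ×-dec (t 1 ≤? b))))))

  aligned-length≤windowsIn : ∀ {t} K → StepsAtMost δ t → a ≤ t 0 → b ≤ t K →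
                      b - t 0 ≤ δ * (windowsIn t a b K + 1ℚ)
  aligned-length≤windowsIn {t} zero steps a≤t₀ b≤t₀ =
    ≤-trans (p≤q⇒p-q≤0 b≤t₀) (*-nonNeg (steps-nonNeg steps) (ℕ→ℚ-nonNeg 1))
  aligned-length≤windowsIn {t} (suc K) steps a≤t₀ b≤tK with t 1 ≤? b
  ... | no t₁≰b = begin
    b - t 0                           ≤⟨ +-monoˡ-≤ (- t 0) (<⇒≤ (≰⇒> t₁≰b)) ⟩
    t 1 - t 0                         ≤⟨ proj₂ (steps 0) ⟩
    δ                                 ≡⟨ *-identityʳ δ ⟨
    δ * 1ℚ                            ≤⟨ *-monoˡ-≤-nonNeg δ {{nonNegative (steps-nonNeg steps)}}
                                           (+-monoˡ-≤ 1ℚ (windowsIn-nonNeg {a} {b} t (suc K))) ⟩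
    δ * (windowsIn t a b (suc K) + 1ℚ) ∎
    where open ≤-Reasoning
  ... | yes t₁≤b = begin
    b - t 0                           ≡⟨ split b (t 0) (t 1) ⟩
    (b - t 1) + (t 1 - t 0)           ≤⟨ +-mono-≤ (aligned-length≤windowsIn K (steps ∘ suc) a≤t₁ b≤tK)
                                                   (proj₂ (steps 0)) ⟩
    δ * (W + 1ℚ) + δ                  ≡⟨ regroup δ W ⟩
    δ * (1ℚ + W + 1ℚ)                 ≡⟨ cong (λ w → δ * (w + W + 1ℚ)) (𝟙-yes first? (a≤t₀ , t₁≤b)) ⟨
    δ * (windowsIn t a b (suc K) + 1ℚ) ∎
    where
    open ≤-Reasoning
    W = windowsIn (t ∘ suc) a b K
    first? = (a ≤? t 0) ×-dec (t 1 ≤? b)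
    a≤t₁ = ≤-trans a≤t₀ (proj₁ (steps 0))
    split : ∀ b t₀ t₁ → b - t₀ ≡ (b - t₁) + (t₁ - t₀)
    split = solve-∀ ℚ-ring
    regroup : ∀ δ W → δ * (W + 1ℚ) + δ ≡ δ * (1ℚ + W + 1ℚ)
    regroup = solve-∀ ℚ-ring

  length≤windowsIn : ∀ {t} K → StepsAtMost δ t → t 0 ≤ a → b ≤ t K →
                     b - a ≤ δ * (windowsIn t a b K + ℕ→ℚ 2)
  length≤windowsIn {t} zero steps t₀≤a b≤t₀ =
    ≤-trans (p≤q⇒p-q≤0 (≤-trans b≤t₀ t₀≤a)) (*-nonNeg (steps-nonNeg steps) (ℕ→ℚ-nonNeg 2))
  length≤windowsIn {t} (suc K) steps t₀≤a b≤tK with t 1 ≤? a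
  ... | yes t₁≤a = begin
    b - a                             ≤⟨ length≤windowsIn K (steps ∘ suc) t₁≤a b≤tK ⟩
    δ * (W + ℕ→ℚ 2)                   ≤⟨ windowsIn-tail≤ t K (steps-nonNeg steps) (ℕ→ℚ 2) ⟩
    δ * (windowsIn t a b (suc K) + ℕ→ℚ 2) ∎
    where
    open ≤-Reasoning
    W = windowsIn (t ∘ suc) a b K
  ... | no t₁≰a = begin
    b - a                             ≡⟨ split b a (t 1) ⟩
    (b - t 1) + (t 1 - a)             ≤⟨ +-mono-≤ (aligned-length≤windowsIn K (steps ∘ suc) (<⇒≤ (≰⇒> t₁≰a)) b≤tK)
                                                   (≤-trans (+-monoʳ-≤ (t 1) (neg-antimono-≤ t₀≤a)) (proj₂ (steps 0))) ⟩
    δ * (W + 1ℚ) + δ                  ≡⟨ regroup δ W ⟩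
    δ * (W + ℕ→ℚ 2)                   ≤⟨ windowsIn-tail≤ t K (steps-nonNeg steps) (ℕ→ℚ 2) ⟩
    δ * (windowsIn t a b (suc K) + ℕ→ℚ 2) ∎
    where
    open ≤-Reasoning
    W = windowsIn (t ∘ suc) a b K
    split : ∀ b a t₁ → b - a ≡ (b - t₁) + (t₁ - a)
    split = solve-∀ ℚ-ring
    regroup : ∀ δ W → δ * (W + 1ℚ) + δ ≡ δ * (W + ℕ→ℚ 2)
    regroup = solve-∀ ℚ-ring

*-suc-middle : ∀ a i b → a ℕ.* suc i ℕ.* b ≡ a ℕ.* i ℕ.* b ℕ.+ a ℕ.* b
*-suc-middle = ℕ-Solver.solve-∀

pow-split : ∀ {l L} → l ℕ.≤ L → 2 ^ l ℕ.* 2 ^ (L ∸ l) ≡ 2 ^ L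
pow-split {l} {L} l≤L = trans (sym (ℕ.^-distribˡ-+-* 2 l (L ∸ l))) (cong (2 ^_) (ℕ.m+[n∸m]≡n l≤L))

level≤L : ∀ {L} (ℓ : Fin (suc L)) → toℕ ℓ ℕ.≤ L
level≤L ℓ = ℕ.s≤s⁻¹ (Fin.toℕ<n ℓ)

size-gap : ∀ {L l l′ c} → l ℕ.+ c ℕ.≤ l′ → l′ ℕ.≤ L → 2 ^ c ℕ.* 2 ^ (L ∸ l′) ℕ.≤ 2 ^ (L ∸ l)
size-gap {L} {l} {l′} {c} l+c≤l′ l′≤L = begin
  2 ^ c ℕ.* 2 ^ (L ∸ l′)  ≡⟨ ℕ.^-distribˡ-+-* 2 c (L ∸ l′) ⟨
  2 ^ (c ℕ.+ (L ∸ l′))    ≤⟨ ℕ.^-monoʳ-≤ 2 (ℕ.m+n≤o⇒m≤o∸n (c ℕ.+ (L ∸ l′)) fits) ⟩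
  2 ^ (L ∸ l)             ∎
  where
  open ℕ.≤-Reasoning
  rearrange : ∀ c m l → c ℕ.+ m ℕ.+ l ≡ l ℕ.+ c ℕ.+ m
  rearrange = ℕ-Solver.solve-∀
  fits : c ℕ.+ (L ∸ l′) ℕ.+ l ℕ.≤ L
  fits = begin
    c ℕ.+ (L ∸ l′) ℕ.+ l   ≡⟨ rearrange c (L ∸ l′) l ⟩
    l ℕ.+ c ℕ.+ (L ∸ l′)   ≤⟨ ℕ.+-monoˡ-≤ (L ∸ l′) l+c≤l′ ⟩
    l′ ℕ.+ (L ∸ l′)        ≡⟨ ℕ.m+[n∸m]≡n l′≤L ⟩
    L                      ∎

horizon : ∀ L (ℓ : Fin (suc L)) → suc L ℕ.* 2 ^ toℕ ℓ ℕ.* 2 ^ (L ∸ toℕ ℓ) ≡ suc L ℕ.* 2 ^ L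
horizon L ℓ = trans (ℕ.*-assoc (suc L) (2 ^ toℕ ℓ) (2 ^ (L ∸ toℕ ℓ))) (cong (suc L ℕ.*_) (pow-split (level≤L ℓ)))

deadline≤horizon : ∀ L (j : Job L) (ℓ′ : Fin (suc L)) →
                   deadline L j ℕ.≤ suc L ℕ.* 2 ^ toℕ ℓ′ ℕ.* 2 ^ (L ∸ toℕ ℓ′)
deadline≤horizon L (ℓ , k) ℓ′ = begin
  suc L ℕ.* suc (toℕ k) ℕ.* 2 ^ (L ∸ toℕ ℓ)
    ≤⟨ ℕ.*-monoˡ-≤ (2 ^ (L ∸ toℕ ℓ)) (ℕ.*-monoʳ-≤ (suc L) (Fin.toℕ<n k)) ⟩
  suc L ℕ.* 2 ^ toℕ ℓ ℕ.* 2 ^ (L ∸ toℕ ℓ)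
    ≡⟨ trans (horizon L ℓ) (sym (horizon L ℓ′)) ⟩
  suc L ℕ.* 2 ^ toℕ ℓ′ ℕ.* 2 ^ (L ∸ toℕ ℓ′) ∎
  where open ℕ.≤-Reasoning

release<deadline : ∀ L (j : Job L) → release L j ℕ.< deadline L j
release<deadline L (ℓ , k) = subst (release L (ℓ , k) ℕ.<_) (sym (*-suc-middle (suc L) (toℕ k) p))
  (ℕ.m<m+n (release L (ℓ , k)) (ℕ.*-mono-≤ {1} {suc L} {1} {p} (s≤s z≤n) (ℕ.m^n>0 2 (L ∸ toℕ ℓ))))
  where p = 2 ^ (L ∸ toℕ ℓ)

level-size : ∀ L (ℓ : Fin (suc L)) → ∑[ k < 2 ^ toℕ ℓ ] ℕ→ℚ (size L (ℓ , k)) ≡ ℕ→ℚ (2 ^ L)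
level-size L ℓ = begin
  ∑[ k < 2 ^ toℕ ℓ ] ℕ→ℚ (2 ^ (L ∸ toℕ ℓ))     ≡⟨ ∑-const (2 ^ toℕ ℓ) (ℕ→ℚ (2 ^ (L ∸ toℕ ℓ))) ⟩
  ℕ→ℚ (2 ^ toℕ ℓ) * ℕ→ℚ (2 ^ (L ∸ toℕ ℓ))      ≡⟨ ℕ→ℚ-* (2 ^ toℕ ℓ) (2 ^ (L ∸ toℕ ℓ)) ⟨
  ℕ→ℚ (2 ^ toℕ ℓ ℕ.* 2 ^ (L ∸ toℕ ℓ))          ≡⟨ cong ℕ→ℚ (pow-split (level≤L ℓ)) ⟩
  ℕ→ℚ (2 ^ L)                                  ∎
  where open ≡-Reasoning

totalSize≡ : ∀ L → totalSize L ≡ ℕ→ℚ (suc L) * ℕ→ℚ (2 ^ L)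
totalSize≡ L = begin
  totalSize L                                  ≡⟨ sumJobs≡∑ⱼ (λ j → ℕ→ℚ (size L j)) ⟩
  ∑[ ℓ < suc L ] ∑[ k < 2 ^ toℕ ℓ ] ℕ→ℚ (size L (ℓ , k))  ≡⟨ sum-cong-≗ {suc L} (level-size L) ⟩
  ∑[ ℓ < suc L ] ℕ→ℚ (2 ^ L)                   ≡⟨ ∑-const (suc L) (ℕ→ℚ (2 ^ L)) ⟩
  ℕ→ℚ (suc L) * ℕ→ℚ (2 ^ L)                    ∎
  where open ≡-Reasoning

module Schedule {L : ℕ} (sol : Solution L) (valid : Valid L sol) where
  open Solution sol renaming (start to s; len to x)

  p r d u : Job L → ℚ
  p j = ℕ→ℚ (size L j)
  r j = ℕ→ℚ (release L j)
  d j = ℕ→ℚ (deadline L j)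
  u j = p j - x j

  len≤size : ∀ j → x j ≤ p j
  len≤size j = proj₂ (proj₁ valid j)

  inside-window : ∀ j t → t ∈⟨ s j , s j + x j ] → t ∈⟨ r j , d j ]
  inside-window = proj₁ (proj₂ valid)

  disjoint : ∀ j j′ → j ≢ j′ → ∀ t → ¬ (t ∈⟨ s j , s j + x j ] × t ∈⟨ s j′ , s j′ + x j′ ])
  disjoint = proj₂ (proj₂ valid)

  completion∈ : ∀ j → 0ℚ < x j → (s j + x j) ∈⟨ s j , s j + x j ]
  completion∈ j 0<x = p<p+q (s j) 0<x , ≤-refl

  within-window : ∀ j → 0ℚ < x j → r j ≤ s j × s j + x j ≤ d j
  within-window j 0<x = release≤start , proj₂ completion-inside
    where
    completion-inside = inside-window j _ (completion∈ j 0<x)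
    release≤start : r j ≤ s j
    release≤start = ≮⇒≥ λ s<r → <-irrefl refl (proj₁ (inside-window j (r j) (s<r , <⇒≤ (proj₁ completion-inside))))

  Covers : Job L → Job L → Set
  Covers j w = s j ≤ r w × d w ≤ s j + x j

  covers? : ∀ j w → Dec (Covers j w)
  covers? j w = (s j ≤? r w) ×-dec (d w ≤? s j + x j)

  covered⇒unprocessed : ∀ {j w} → j ≢ w → Covers j w → x w ≤ 0ℚ
  covered⇒unprocessed {j} {w} j≢w (s≤r , d≤e) = ≮⇒≥ λ 0<x →
    let r<e , e≤d = inside-window w _ (completion∈ w 0<x)
    in disjoint j w j≢w (s w + x w) ((≤-<-trans s≤r r<e , ≤-trans e≤d d≤e) , completion∈ w 0<x)

  covered-once : ∀ {j j′ w} → j ≢ j′ → Covers j w → Covers j′ w → ⊥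
  covered-once {j} {j′} {w} j≢j′ (s≤r , d≤e) (s′≤r , d≤e′) =
    disjoint j j′ j≢j′ (d w) ((≤-<-trans s≤r r<d , d≤e) , (≤-<-trans s′≤r r<d , d≤e′))
    where r<d = ℕ→ℚ-mono-< (release<deadline L w)

  lost : Fin (suc L) → ℚ
  lost ℓ = ∑[ k < 2 ^ toℕ ℓ ] u (ℓ , k)

  lost-nonNeg : ∀ ℓ → 0ℚ ≤ lost ℓ
  lost-nonNeg ℓ = ∑-nonNeg {2 ^ toℕ ℓ} λ k → p≤q⇒0≤q-p (len≤size (ℓ , k))

  module BigJobs (H : ℕ) where

    big? : (j : Job L) → Dec (toℕ (proj₁ j) ℕ.< H)
    big? j = toℕ (proj₁ j) ℕ.<? H

    lostOnBig : ℚ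
    lostOnBig = ∑[ ℓ < suc L ] (𝟙 (toℕ ℓ ℕ.<? H) * lost ℓ)

    lostOnBig-nonNeg : 0ℚ ≤ lostOnBig
    lostOnBig-nonNeg = ∑-nonNeg {suc L} λ ℓ → *-nonNeg (𝟙-nonNeg (toℕ ℓ ℕ.<? H)) (lost-nonNeg ℓ)

    covering : Job L → Job L → ℚ
    covering j w = 𝟙 (big? j ×-dec covers? j w)

    covering-loss : ∀ w → H ℕ.≤ toℕ (proj₁ w) → p w * ∑ⱼ L (λ j → covering j w) ≤ u w
    covering-loss w H≤w = by-cases (0ℚ <? S)
      where
      open ≤-Reasoning
      S = ∑ⱼ L (λ j → covering j w)
      instance
        p-nonNeg : NonNegative (p w)
        p-nonNeg = nonNegative (ℕ→ℚ-nonNeg (size L w))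
      S≤1 : S ≤ 1ℚ
      S≤1 = ∑ⱼ-≤1 (λ j → 𝟙-nonNeg (big? j ×-dec covers? j w)) (λ j → 𝟙≤1 (big? j ×-dec covers? j w))
              λ i i′ i≢i′ 0<cᵢ 0<cᵢ′ → covered-once {i} {i′} {w} i≢i′ (proj₂ (𝟙-pos⇒ (big? i ×-dec covers? i w) 0<cᵢ))
                                                         (proj₂ (𝟙-pos⇒ (big? i′ ×-dec covers? i′ w) 0<cᵢ′))
      unprocessed : 0ℚ < S → x w ≤ 0ℚ
      unprocessed 0<S = covered⇒unprocessed j≢w (proj₂ j-big×covers)
        where
        j = proj₁ (∑ⱼ-pos⇒ (λ j → covering j w) 0<S)
        j-big×covers = 𝟙-pos⇒ (big? j ×-dec covers? j w) (proj₂ (∑ⱼ-pos⇒ (λ j → covering j w) 0<S))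
        j≢w : j ≢ w
        j≢w j≡w = ℕ.<⇒≢ (ℕ.<-≤-trans (proj₁ j-big×covers) H≤w) (cong (toℕ ∘ proj₁) j≡w)
      by-cases : Dec (0ℚ < S) → p w * S ≤ u w
      by-cases (no 0≮S) = begin
        p w * S   ≤⟨ *-monoˡ-≤-nonNeg (p w) (≮⇒≥ 0≮S) ⟩
        p w * 0ℚ  ≡⟨ *-zeroʳ (p w) ⟩
        0ℚ        ≤⟨ p≤q⇒0≤q-p (len≤size w) ⟩
        u w       ∎
      by-cases (yes 0<S) = begin
        p w * S   ≤⟨ *-monoˡ-≤-nonNeg (p w) S≤1 ⟩
        p w * 1ℚ  ≡⟨ *-identityʳ (p w) ⟩
        p w       ≡⟨ +-identityʳ (p w) ⟨
        p w + 0ℚ  ≤⟨ +-monoʳ-≤ (p w) (neg-antimono-≤ (unprocessed 0<S)) ⟩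
        u w       ∎

    big-size : H ℕ.≤ suc L → ∑ⱼ L (λ j → 𝟙 (big? j) * p j) ≡ ℕ→ℚ H * ℕ→ℚ (2 ^ L)
    big-size H≤1+L = begin
      ∑ⱼ L (λ j → 𝟙 (big? j) * p j)                          ≡⟨ ∑ⱼ-by-level (λ ℓ → 𝟙 (toℕ ℓ ℕ.<? H)) p ⟩
      ∑[ ℓ < suc L ] (𝟙 (toℕ ℓ ℕ.<? H) * ∑[ k < 2 ^ toℕ ℓ ] p (ℓ , k))
        ≡⟨ sum-cong-≗ {suc L} (λ ℓ → cong (𝟙 (toℕ ℓ ℕ.<? H) *_) (level-size L ℓ)) ⟩
      ∑[ ℓ < suc L ] (𝟙 (toℕ ℓ ℕ.<? H) * ℕ→ℚ (2 ^ L))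
        ≡⟨ *-distribʳ-sum {suc L} (ℕ→ℚ (2 ^ L)) (λ ℓ → 𝟙 (toℕ ℓ ℕ.<? H)) ⟨
      ∑[ ℓ < suc L ] 𝟙 (toℕ ℓ ℕ.<? H) * ℕ→ℚ (2 ^ L)          ≡⟨ cong (_* ℕ→ℚ (2 ^ L)) (∑-𝟙-< H≤1+L) ⟩
      ℕ→ℚ H * ℕ→ℚ (2 ^ L)                                    ∎
      where open ≡-Reasoning

    module DeepLevels (c : ℕ) where

      Q N : ℚ
      Q = ℕ→ℚ (2 ^ c)
      N = ℕ→ℚ (suc L)

      module _ (ℓ′ : Fin (suc L)) (H+c≤ℓ′ : H ℕ.+ c ℕ.≤ toℕ ℓ′) where

        p′ : ℕ
        p′ = 2 ^ (L ∸ toℕ ℓ′)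

        -- The job (ℓ′ , k) has window (grid k , grid (k + 1)], so that
        -- windowsCovered j is windowsIn grid for the processing interval of j.
        grid : ℕ → ℚ
        grid i = ℕ→ℚ (suc L ℕ.* i ℕ.* p′)

        grid-steps : StepsAtMost (ℕ→ℚ (suc L ℕ.* p′)) grid
        grid-steps i = ℕ→ℚ-mono-≤ (subst (suc L ℕ.* i ℕ.* p′ ℕ.≤_) (sym step) (ℕ.m≤m+n _ _)) ,
                       ≤-reflexive (trans (cong (_- grid i) grid-suc) (p+q-p≡q (grid i) (ℕ→ℚ (suc L ℕ.* p′))))
          where
          step = *-suc-middle (suc L) i p′
          grid-suc : grid (suc i) ≡ grid i + ℕ→ℚ (suc L ℕ.* p′)
          grid-suc = trans (cong ℕ→ℚ step) (ℕ→ℚ-+ (suc L ℕ.* i ℕ.* p′) (suc L ℕ.* p′))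

        windowsCovered : Job L → ℚ
        windowsCovered j = ∑[ k < 2 ^ toℕ ℓ′ ] 𝟙 (covers? j (ℓ′ , k))

        len≤windowsCovered : ∀ j → x j ≤ N * ℕ→ℚ p′ * (windowsCovered j + ℕ→ℚ 2)
        len≤windowsCovered j = by-cases (0ℚ <? x j)
          where
          by-cases : Dec (0ℚ < x j) → x j ≤ N * ℕ→ℚ p′ * (windowsCovered j + ℕ→ℚ 2)
          by-cases (no 0≮x) = ≤-trans (≮⇒≥ 0≮x) (*-nonNeg (*-nonNeg (ℕ→ℚ-nonNeg (suc L)) (ℕ→ℚ-nonNeg p′))
                                (+-mono-≤ (windowsIn-nonNeg {s j} {s j + x j} grid (2 ^ toℕ ℓ′)) (ℕ→ℚ-nonNeg 2)))
          by-cases (yes 0<x) =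
            subst₂ _≤_ (p+q-p≡q (s j) (x j)) (cong (_* (windowsCovered j + ℕ→ℚ 2)) (ℕ→ℚ-* (suc L) p′))
              (length≤windowsIn (2 ^ toℕ ℓ′) grid-steps grid₀≤s completion≤horizon)
            where
            grid₀≡0 : grid 0 ≡ 0ℚ
            grid₀≡0 = cong (λ n → ℕ→ℚ (n ℕ.* p′)) (ℕ.*-zeroʳ (suc L))
            grid₀≤s : grid 0 ≤ s j
            grid₀≤s = subst (_≤ s j) (sym grid₀≡0) (≤-trans (ℕ→ℚ-nonNeg (release L j)) (proj₁ (within-window j 0<x)))
            completion≤horizon : s j + x j ≤ grid (2 ^ toℕ ℓ′)
            completion≤horizon = ≤-trans (proj₂ (within-window j 0<x)) (ℕ→ℚ-mono-≤ (deadline≤horizon L j ℓ′))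

        big-job-bound : ∀ j → toℕ (proj₁ j) ℕ.< H →
                  (Q - (N + N)) * p j ≤ Q * u j + Q * N * ℕ→ℚ p′ * windowsCovered j
        big-job-bound j@(ℓ , k) ℓ<H = ≤-by-difference _ (certificate Q N (ℕ→ℚ p′) (windowsCovered j) (x j) (p j))
          (+-mono-≤ (*-nonNeg (ℕ→ℚ-nonNeg (2 ^ c)) (p≤q⇒0≤q-p (len≤windowsCovered j)))
                    (*-nonNeg (+-mono-≤ (ℕ→ℚ-nonNeg (suc L)) (ℕ→ℚ-nonNeg (suc L))) (p≤q⇒0≤q-p Qp′≤p)))
          where
          certificate : ∀ Q N p′ C x p →
            Q * (p - x) + Q * N * p′ * C - (Q - (N + N)) * p ≡ Q * (N * p′ * (C + ℕ→ℚ 2) - x) + (N + N) * (p - Q * p′)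
          certificate = solve-∀ ℚ-ring
          Qp′≤p : Q * ℕ→ℚ p′ ≤ p j
          Qp′≤p = subst (_≤ p j) (ℕ→ℚ-* (2 ^ c) p′)
            (ℕ→ℚ-mono-≤ (size-gap {L} {toℕ ℓ} {toℕ ℓ′} {c} (ℕ.≤-trans (ℕ.<⇒≤ (ℕ.+-monoˡ-< c ℓ<H)) H+c≤ℓ′) (level≤L ℓ′)))

        weighted-big-job-bound : ∀ j → (Q - (N + N)) * (𝟙 (big? j) * p j) ≤
                             Q * (𝟙 (big? j) * u j) + Q * N * ℕ→ℚ p′ * (𝟙 (big? j) * windowsCovered j)
        weighted-big-job-bound j = by-cases (big? j)
          where
          by-cases : (b? : Dec (toℕ (proj₁ j) ℕ.< H)) →
                     (Q - (N + N)) * (𝟙 b? * p j) ≤ Q * (𝟙 b? * u j) + Q * N * ℕ→ℚ p′ * (𝟙 b? * windowsCovered j)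
          by-cases (yes j<H) = subst₂ _≤_ (sym (cong ((Q - (N + N)) *_) (*-identityˡ (p j))))
            (sym (cong₂ _+_ (cong (Q *_) (*-identityˡ (u j)))
                            (cong (Q * N * ℕ→ℚ p′ *_) (*-identityˡ (windowsCovered j)))))
            (big-job-bound j j<H)
          by-cases (no _) = ≤-reflexive (vanish (Q - (N + N)) (p j) Q (u j) (Q * N * ℕ→ℚ p′) (windowsCovered j))
            where
            vanish : ∀ a b e f g h → a * (0ℚ * b) ≡ e * (0ℚ * f) + g * (0ℚ * h)
            vanish = solve-∀ ℚ-ring

        H≤ℓ′ : H ℕ.≤ toℕ ℓ′
        H≤ℓ′ = ℕ.≤-trans (ℕ.m≤m+n H c) H+c≤ℓ′

        covered-windows-lost : ℕ→ℚ p′ * ∑ⱼ L (λ j → 𝟙 (big? j) * windowsCovered j) ≤ lost ℓ′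
        covered-windows-lost = begin
          ℕ→ℚ p′ * ∑ⱼ L (λ j → 𝟙 (big? j) * windowsCovered j)
            ≡⟨ cong (ℕ→ℚ p′ *_) (∑ⱼ-cong λ j → trans (*-distribˡ-sum (𝟙 (big? j)) (λ k → 𝟙 (covers? j (ℓ′ , k))))
                                  (sum-cong-≗ {2 ^ toℕ ℓ′} λ k → sym (𝟙-×-dec (big? j) (covers? j (ℓ′ , k))))) ⟩
          ℕ→ℚ p′ * ∑ⱼ L (λ j → ∑[ k < 2 ^ toℕ ℓ′ ] covering j (ℓ′ , k))
            ≡⟨ cong (ℕ→ℚ p′ *_) (∑-∑ⱼ-comm (λ k j → covering j (ℓ′ , k))) ⟨
          ℕ→ℚ p′ * ∑[ k < 2 ^ toℕ ℓ′ ] ∑ⱼ L (λ j → covering j (ℓ′ , k))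
            ≡⟨ *-distribˡ-sum (ℕ→ℚ p′) (λ k → ∑ⱼ L (λ j → covering j (ℓ′ , k))) ⟩
          ∑[ k < 2 ^ toℕ ℓ′ ] (ℕ→ℚ p′ * ∑ⱼ L (λ j → covering j (ℓ′ , k)))
            ≤⟨ ∑-mono-≤ (λ k → covering-loss (ℓ′ , k) H≤ℓ′) ⟩
          lost ℓ′ ∎
          where open ≤-Reasoning

        deep-level-bound : (Q - (N + N)) * (ℕ→ℚ H * ℕ→ℚ (2 ^ L)) ≤ Q * lostOnBig + Q * N * lost ℓ′
        deep-level-bound = begin
          (Q - (N + N)) * (ℕ→ℚ H * ℕ→ℚ (2 ^ L))
            ≡⟨ cong ((Q - (N + N)) *_) (big-size H≤1+L) ⟨
          (Q - (N + N)) * ∑ⱼ L (λ j → 𝟙 (big? j) * p j)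
            ≡⟨ *-distribˡ-∑ⱼ (Q - (N + N)) (λ j → 𝟙 (big? j) * p j) ⟩
          ∑ⱼ L (λ j → (Q - (N + N)) * (𝟙 (big? j) * p j))
            ≤⟨ ∑ⱼ-mono-≤ weighted-big-job-bound ⟩
          ∑ⱼ L (λ j → Q * bigU j + Q * N * ℕ→ℚ p′ * bigC j)
            ≡⟨ ∑ⱼ-distrib-+ (λ j → Q * bigU j) (λ j → Q * N * ℕ→ℚ p′ * bigC j) ⟩
          ∑ⱼ L (λ j → Q * bigU j) + ∑ⱼ L (λ j → Q * N * ℕ→ℚ p′ * bigC j)
            ≡⟨ cong₂ _+_ (*-distribˡ-∑ⱼ Q bigU) (*-distribˡ-∑ⱼ (Q * N * ℕ→ℚ p′) bigC) ⟨
          Q * ∑ⱼ L bigU + Q * N * ℕ→ℚ p′ * ∑ⱼ L bigC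
            ≡⟨ cong₂ _+_ (cong (Q *_) (∑ⱼ-by-level (λ ℓ → 𝟙 (toℕ ℓ ℕ.<? H)) u))
                         (*-assoc (Q * N) (ℕ→ℚ p′) (∑ⱼ L bigC)) ⟩
          Q * lostOnBig + Q * N * (ℕ→ℚ p′ * ∑ⱼ L bigC)
            ≤⟨ +-monoʳ-≤ (Q * lostOnBig) (*-monoˡ-≤-nonNeg (Q * N) {{nonNegative QN≥0}} covered-windows-lost) ⟩
          Q * lostOnBig + Q * N * lost ℓ′ ∎
          where
          open ≤-Reasoning
          bigU bigC : Job L → ℚ
          bigU j = 𝟙 (big? j) * u j
          bigC j = 𝟙 (big? j) * windowsCovered j
          H≤1+L : H ℕ.≤ suc L
          H≤1+L = ℕ.≤-trans H≤ℓ′ (ℕ.<⇒≤ (Fin.toℕ<n ℓ′))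
          QN≥0 : 0ℚ ≤ Q * N
          QN≥0 = *-nonNeg (ℕ→ℚ-nonNeg (2 ^ c)) (ℕ→ℚ-nonNeg (suc L))

      levels-bound : Q * N * lostOnBig +
                     ℕ→ℚ (suc L ∸ (H ℕ.+ c)) * ((Q - (N + N)) * (ℕ→ℚ H * ℕ→ℚ (2 ^ L)) - Q * lostOnBig)
                     ≤ Q * N * ∑[ ℓ < suc L ] lost ℓ
      levels-bound = begin
        Q * N * lostOnBig + ℕ→ℚ (suc L ∸ g) * β
          ≡⟨ cong (λ m → Q * N * lostOnBig + m * β) (∑-𝟙-≥ (suc L) g) ⟨
        Q * N * lostOnBig + ∑[ ℓ < suc L ] 𝟙 (deep? ℓ) * β
          ≡⟨ cong₂ _+_ (*-distribˡ-sum (Q * N) (λ ℓ → 𝟙 (small? ℓ) * lost ℓ))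
                       (*-distribʳ-sum β (λ ℓ → 𝟙 (deep? ℓ))) ⟩
        ∑[ ℓ < suc L ] (Q * N * (𝟙 (small? ℓ) * lost ℓ)) + ∑[ ℓ < suc L ] (𝟙 (deep? ℓ) * β)
          ≡⟨ ∑-distrib-+ (λ ℓ → Q * N * (𝟙 (small? ℓ) * lost ℓ)) (λ ℓ → 𝟙 (deep? ℓ) * β) ⟨
        ∑[ ℓ < suc L ] (Q * N * (𝟙 (small? ℓ) * lost ℓ) + 𝟙 (deep? ℓ) * β)
          ≤⟨ ∑-mono-≤ per-level ⟩
        ∑[ ℓ < suc L ] (Q * N * lost ℓ)
          ≡⟨ *-distribˡ-sum (Q * N) lost ⟨
        Q * N * ∑[ ℓ < suc L ] lost ℓ ∎
        where
        open ≤-Reasoning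
        g = H ℕ.+ c
        β = (Q - (N + N)) * (ℕ→ℚ H * ℕ→ℚ (2 ^ L)) - Q * lostOnBig
        small? deep? : (ℓ : Fin (suc L)) → Dec _
        small? ℓ = toℕ ℓ ℕ.<? H
        deep? ℓ = g ℕ.≤? toℕ ℓ
        per-level : ∀ ℓ → Q * N * (𝟙 (small? ℓ) * lost ℓ) + 𝟙 (deep? ℓ) * β ≤ Q * N * lost ℓ
        per-level ℓ = by-cases (small? ℓ) (deep? ℓ)
          where
          by-cases : (s? : Dec (toℕ ℓ ℕ.< H)) (d? : Dec (g ℕ.≤ toℕ ℓ)) →
                     Q * N * (𝟙 s? * lost ℓ) + 𝟙 d? * β ≤ Q * N * lost ℓ
          by-cases (yes ℓ<H) (yes g≤ℓ) = ⊥-elim (ℕ.<⇒≱ ℓ<H (ℕ.≤-trans (ℕ.m≤m+n H c) g≤ℓ))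
          by-cases (yes _)   (no _)    = ≤-reflexive (only-small (Q * N) (lost ℓ) β)
            where
            only-small : ∀ a l b → a * (1ℚ * l) + 0ℚ * b ≡ a * l
            only-small = solve-∀ ℚ-ring
          by-cases (no _)    (yes g≤ℓ) = subst (_≤ Q * N * lost ℓ) (sym (only-deep (Q * N) (lost ℓ) β))
                                           (p≤q+r⇒p-q≤r (deep-level-bound ℓ g≤ℓ))
            where
            only-deep : ∀ a l b → a * (0ℚ * l) + 1ℚ * b ≡ b
            only-deep = solve-∀ ℚ-ring
          by-cases (no _)    (no _)    = subst (_≤ Q * N * lost ℓ) (sym (neither (Q * N) (lost ℓ) β))
            (*-nonNeg (*-nonNeg (ℕ→ℚ-nonNeg (2 ^ c)) (ℕ→ℚ-nonNeg (suc L))) (lost-nonNeg ℓ))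
            where
            neither : ∀ a l b → a * (0ℚ * l) + 0ℚ * b ≡ 0ℚ
            neither = solve-∀ ℚ-ring

      cost-bound : ℕ→ℚ (suc L ∸ (H ℕ.+ c)) * ((Q - (N + N)) * (ℕ→ℚ H * ℕ→ℚ (2 ^ L))) ≤ Q * N * ∑[ ℓ < suc L ] lost ℓ
      cost-bound = ≤-by-difference _ (split Q N M lostOnBig B (∑[ ℓ < suc L ] lost ℓ))
        (+-mono-≤ (p≤q⇒0≤q-p levels-bound)
                  (*-nonNeg (*-nonNeg (ℕ→ℚ-nonNeg (2 ^ c)) (p≤q⇒0≤q-p M≤N)) lostOnBig-nonNeg))
        where
        M = ℕ→ℚ (suc L ∸ (H ℕ.+ c))
        B = (Q - (N + N)) * (ℕ→ℚ H * ℕ→ℚ (2 ^ L))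
        M≤N : M ≤ N
        M≤N = ℕ→ℚ-mono-≤ (ℕ.m∸n≤m (suc L) (H ℕ.+ c))
        split : ∀ Q N M A B C →
          Q * N * C - M * B ≡ (Q * N * C - (Q * N * A + M * (B - Q * A))) + Q * (N - M) * A
        split = solve-∀ ℚ-ring

final-arithmetic : ∀ {h z C M Q N} → Q ≡ h * ℕ→ℚ 64 → N ≡ h + h → 0ℚ < h → 0ℚ ≤ z → ℕ→ℚ 7 * h ≤ ℕ→ℚ 8 * M →
                   M * ((Q - (N + N)) * (h * z)) ≤ Q * N * C → N * z ≤ ℕ→ℚ 5 * C
final-arithmetic {h} {z} {C} {M} refl refl 0<h 0≤z 7h≤8M bound =
  ≤-by-difference _ refl (*-cancelˡ-≤-pos (ℕ→ℚ 256)
    (subst₂ _≤_ (sym (*-zeroʳ (ℕ→ℚ 256))) (sym (certificate h z C M))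
      (+-mono-≤ (+-mono-≤ (*-nonNeg (ℕ→ℚ-nonNeg 10) (p≤q⇒0≤q-p 60Mz≤128C))
                          (*-nonNeg (*-nonNeg (ℕ→ℚ-nonNeg 75) 0≤z) (p≤q⇒0≤q-p 7h≤8M)))
                (*-nonNeg (*-nonNeg (ℕ→ℚ-nonNeg 13) 0≤h) 0≤z))))
  where
  0≤h = <⇒≤ 0<h
  60Mz≤128C : ℕ→ℚ 60 * (M * z) ≤ ℕ→ℚ 128 * C
  60Mz≤128C = *-cancelˡ-≤-pos (h * h) {{pos*pos⇒pos h {{positive 0<h}} h {{positive 0<h}}}}
    (subst₂ _≤_ (as-square h z M) (as-square′ h C) bound)
    where
    as-square : ∀ h z M → M * ((h * ℕ→ℚ 64 - (h + h + (h + h))) * (h * z)) ≡ h * h * (ℕ→ℚ 60 * (M * z))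
    as-square = solve-∀ ℚ-ring
    as-square′ : ∀ h C → h * ℕ→ℚ 64 * (h + h) * C ≡ h * h * (ℕ→ℚ 128 * C)
    as-square′ = solve-∀ ℚ-ring
  certificate : ∀ h z C M → ℕ→ℚ 256 * (ℕ→ℚ 5 * C - (h + h) * z) ≡
    ℕ→ℚ 10 * (ℕ→ℚ 128 * C - ℕ→ℚ 60 * (M * z)) + ℕ→ℚ 75 * z * (ℕ→ℚ 8 * M - ℕ→ℚ 7 * h) + ℕ→ℚ 13 * h * z
  certificate = solve-∀ ℚ-ring

many-deep-levels : ∀ H c → 8 ℕ.* c ℕ.≤ H → 7 ℕ.* H ℕ.≤ 8 ℕ.* ((H ℕ.+ H) ∸ (H ℕ.+ c))
many-deep-levels H c 8c≤H = begin
  7 ℕ.* H                        ≤⟨ ℕ.m+n≤o⇒m≤o∸n (7 ℕ.* H) 7H+8c≤8H ⟩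
  8 ℕ.* H ∸ 8 ℕ.* c              ≡⟨ ℕ.*-distribˡ-∸ 8 H c ⟨
  8 ℕ.* (H ∸ c)                  ≡⟨ cong (8 ℕ.*_) (ℕ.[m+n]∸[m+o]≡n∸o H H c) ⟨
  8 ℕ.* ((H ℕ.+ H) ∸ (H ℕ.+ c))  ∎
  where
  open ℕ.≤-Reasoning
  7H+H≡8H : ∀ H → 7 ℕ.* H ℕ.+ H ≡ 8 ℕ.* H
  7H+H≡8H = ℕ-Solver.solve-∀
  7H+8c≤8H : 7 ℕ.* H ℕ.+ 8 ℕ.* c ℕ.≤ 8 ℕ.* H
  7H+8c≤8H = ℕ.≤-trans (ℕ.+-monoʳ-≤ (7 ℕ.* H) 8c≤H) (ℕ.≤-reflexive (7H+H≡8H H))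

8[m+6]≤2^m : ∀ m → 7 ℕ.≤ m → 8 ℕ.* (m ℕ.+ 6) ℕ.≤ 2 ^ m
8[m+6]≤2^m m 7≤m = subst (λ n → 8 ℕ.* (n ℕ.+ 6) ℕ.≤ 2 ^ n) (ℕ.m∸n+n≡m 7≤m) (from-7 (m ∸ 7))
  where
  open ℕ.≤-Reasoning
  from-7 : ∀ k → 8 ℕ.* (k ℕ.+ 7 ℕ.+ 6) ℕ.≤ 2 ^ (k ℕ.+ 7)
  from-7 zero    = ℕ.m≤m+n 104 24
  from-7 (suc k) = begin
    8 ℕ.* suc (k ℕ.+ 7 ℕ.+ 6)        ≡⟨ ℕ.*-suc 8 (k ℕ.+ 7 ℕ.+ 6) ⟩
    8 ℕ.+ 8 ℕ.* (k ℕ.+ 7 ℕ.+ 6)      ≤⟨ ℕ.+-mono-≤ 8≤2^[k+7] (from-7 k) ⟩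
    2 ^ (k ℕ.+ 7) ℕ.+ 2 ^ (k ℕ.+ 7)  ≡⟨ cong (2 ^ (k ℕ.+ 7) ℕ.+_) (ℕ.+-identityʳ (2 ^ (k ℕ.+ 7))) ⟨
    2 ^ suc (k ℕ.+ 7)                ∎
    where
    8≤2^[k+7] : 8 ℕ.≤ 2 ^ (k ℕ.+ 7)
    8≤2^[k+7] = ℕ.^-monoʳ-≤ 2 (ℕ.≤-trans (ℕ.m≤m+n 3 4) (ℕ.m≤n+m 7 k))

exponent≥8 : ∀ {L m} → 255 ℕ.≤ L → suc L ≡ 2 ^ m → 8 ℕ.≤ m
exponent≥8 {L} {m} 255≤L 1+L≡2^m = ℕ.≮⇒≥ λ m<8 → ℕ.<⇒≱ (ℕ.m<m+n 128 (s≤s z≤n)) (begin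
  256     ≤⟨ s≤s 255≤L ⟩
  suc L   ≡⟨ 1+L≡2^m ⟩
  2 ^ m   ≤⟨ ℕ.^-monoʳ-≤ 2 (ℕ.s≤s⁻¹ m<8) ⟩
  2 ^ 7   ∎)
  where open ℕ.≤-Reasoning

tree-bound : ∀ {L m} (sol : Solution L) → Valid L sol → 8 ℕ.≤ m → suc L ≡ 2 ^ m →
             totalSize L ≤ ℕ→ℚ 5 * cost L sol
tree-bound {L} {suc m} sol valid (s≤s 7≤m) 1+L≡2H = begin
  totalSize L                 ≡⟨ totalSize≡ L ⟩
  N * z                       ≤⟨ final-arithmetic {h} {z} {cost L sol} {M} Q≡64h N≡2h 0<h (ℕ→ℚ-nonNeg (2 ^ L)) 7h≤8M
                                   (subst (λ t → M * ((Q - (N + N)) * (h * z)) ≤ Q * N * t)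
                                          (sym (sumJobs≡∑ⱼ u)) cost-bound) ⟩
  ℕ→ℚ 5 * cost L sol          ∎
  where
  open ≤-Reasoning
  H = 2 ^ m
  c = m ℕ.+ 6
  open Schedule sol valid
  open BigJobs H
  open DeepLevels c
  h z M : ℚ
  h = ℕ→ℚ H
  z = ℕ→ℚ (2 ^ L)
  M = ℕ→ℚ (suc L ∸ (H ℕ.+ c))
  1+L≡H+H : suc L ≡ H ℕ.+ H
  1+L≡H+H = trans 1+L≡2H (cong (H ℕ.+_) (ℕ.+-identityʳ H))
  Q≡64h : Q ≡ h * ℕ→ℚ 64
  Q≡64h = trans (cong ℕ→ℚ (ℕ.^-distribˡ-+-* 2 m 6)) (ℕ→ℚ-* H 64)
  N≡2h : N ≡ h + h
  N≡2h = trans (cong ℕ→ℚ 1+L≡H+H) (ℕ→ℚ-+ H H)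
  0<h : 0ℚ < h
  0<h = ℕ→ℚ-mono-< (ℕ.m^n>0 2 m)
  7h≤8M : ℕ→ℚ 7 * h ≤ ℕ→ℚ 8 * M
  7h≤8M = subst₂ _≤_ (ℕ→ℚ-* 7 H) (ℕ→ℚ-* 8 (suc L ∸ (H ℕ.+ c)))
    (ℕ→ℚ-mono-≤ (subst (λ n → 7 ℕ.* H ℕ.≤ 8 ℕ.* (n ∸ (H ℕ.+ c))) (sym 1+L≡H+H)
      (many-deep-levels H c (8[m+6]≤2^m m 7≤m))))

lemma14 : Σ ℕ (λ L₀ → (L : ℕ) → L ≥ L₀ → ∃ (λ m → suc L ≡ 2 ^ m) →
    (sol : Solution L) → Valid L sol →
    totalSize L ≤ ℕ→ℚ 5 * cost L sol)
lemma14 = 255 , λ L 255≤L (m , 1+L≡2^m) sol valid → tree-bound {L} {m} sol valid (exponent≥8 255≤L 1+L≡2^m) 1+L≡2^m
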